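{- Let $n\geq 3$. In any tiling of a $3\times n$ rectangle by $T$-tetrominos and monominos, every $3\times 3$ box (i.e., the set of all cells lying in any three consecutive columns of the rectangle) contains at least one monomino.
   Context: The $T$-tetromino is the polyomino formed by four unit squares: three in a row together with a fourth square attached to the middle square of that row. A tiling of a $3\times n$ rectangle (3 rows, $n$ columns of unit cells) by $T$-tetrominos and monominos is a partition of its cells into copies of the $T$-tetromino (in any rotation or reflection, aligned with the grid) and single cells (monominos). -}

module Defs where

open import Data.Nat using (ℕ; suc; _+_; _<_; _≤_)
open import Data.Product using (Σ; ∃; _×_; _,_)
open import Data.Fin using (Fin)
import Data.Sum
open import Data.List using (List; []; _∷_; length; lookup)
open import Data.List.Membership.Propositional using (_∈_)
open import Data.List.Relation.Binary.Permutation.Propositional using (_↭_)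
open import Relation.Binary.PropositionalEquality using (_≡_)

-- A cell is (row , column); rows 0..2, columns 0..n-1.
Cell : Set
Cell = ℕ × ℕ

InRect : ℕ → Cell → Set
InRect n (r , c) = (r < 3) × (c < n)

-- The four orientations of the T-tetromino (reflections of T coincide with rotations).
data Orientation : Set where
  stemDown stemUp stemRight stemLeft : Orientation

-- The cells of a T-tetromino with the given orientation, translated so that
-- its bounding box has top-left corner (r , c).
tCells : Orientation → ℕ → ℕ → List Cell
tCells stemDown  r c = (r , c) ∷ (r , c + 1) ∷ (r , c + 2) ∷ (r + 1 , c + 1) ∷ []
tCells stemUp    r c = (r + 1 , c) ∷ (r + 1 , c + 1) ∷ (r + 1 , c + 2) ∷ (r , c + 1) ∷ []
tCells stemRight r c = (r , c) ∷ (r + 1 , c) ∷ (r + 2 , c) ∷ (r + 1 , c + 1) ∷ []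
tCells stemLeft  r c = (r , c + 1) ∷ (r + 1 , c + 1) ∷ (r + 2 , c + 1) ∷ (r + 1 , c) ∷ []

IsTetromino : List Cell → Set
IsTetromino p = Σ Orientation λ o → Σ ℕ λ r → Σ ℕ λ c → p ↭ tCells o r c

IsMonomino : List Cell → Set
IsMonomino p = Σ Cell λ x → p ≡ x ∷ []

record Tiling (n : ℕ) : Set where
  field
    pieces   : List (List Cell)
    shape    : (i : Fin (length pieces)) →
               IsTetromino (lookup pieces i) Data.Sum.⊎ IsMonomino (lookup pieces i)
    inside   : (i : Fin (length pieces)) → (x : Cell) → x ∈ lookup pieces i → InRect n x
    covers   : (x : Cell) → InRect n x →
               Σ (Fin (length pieces)) λ i →
                 (x ∈ lookup pieces i) ×
                 ((j : Fin (length pieces)) → x ∈ lookup pieces j → j ≡ i)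

module Submission where

-- Suppose the box in columns k, k+1, k+2 contains no monomino, so each of its
-- nine cells lies in a T-tetromino of the tiling.  The 3 × 3 bounding box of a
-- T-tetromino meeting the box lies in columns k-2 .. k+4, so translating it by
-- 2 - k columns yields a "window placement": an orientation, a top row r ≤ 2
-- and a left column d ≤ 4, with all cells in rows 0, 1, 2.  Two pieces of a
-- tiling that share a cell are equal, so if the placements obtained for two box
-- cells meet, each contains the other.  A finite search shows that the nine box
-- cells admit no such family of placements.

open import Defs
open import Data.Nat using (ℕ; _+_; _∸_; _<_; _≤_; _<?_)
open import Data.Nat.Properties
  using (+-assoc; +-comm; +-identityʳ; +-cancelˡ-≡; +-monoʳ-≤; +-monoʳ-<;
         m≤m+n; m+[n∸m]≡n; ≤-trans; <-≤-trans; ≤-<-trans)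
import Data.Nat.Properties as ℕ
open import Data.Product using (Σ; ∃; _×_; _,_; proj₁; proj₂)
import Data.Product.Properties as Product
open import Data.Fin using (Fin; toℕ; zero; suc)
open import Data.Fin.Properties using (toℕ<n; toℕ≤pred[n])
open import Data.Sum using (_⊎_; inj₁; inj₂)
open import Data.Empty using (⊥; ⊥-elim)
open import Data.List
  using (List; []; _∷_; length; lookup; map; filter; cartesianProduct; upTo; allFin)
open import Data.List.Relation.Unary.All using (All; all?; tabulate)
import Data.List.Relation.Unary.All as All
open import Data.List.Relation.Unary.All.Properties using (map⁺)
open import Data.List.Relation.Unary.Any using (Any; any?; here; there)
open import Data.List.Membership.Propositional using (_∈_; find)
open import Data.List.Membership.Propositional.Properties
  using (∈-map⁺; ∈-map⁻; ∈-filter⁺; ∈-cartesianProduct⁺; ∈-upTo⁺; ∈-allFin)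
open import Data.List.Membership.DecPropositional (Product.≡-dec ℕ._≟_ ℕ._≟_)
  using (_∈?_)
open import Data.List.Relation.Binary.Permutation.Propositional using (_↭_; ↭-sym)
import Data.List.Relation.Binary.Permutation.Propositional.Properties as ↭
open import Relation.Nullary using (Dec; no)
open import Relation.Nullary.Decidable using (_→-dec_; _×-dec_; toWitness)
open import Relation.Binary.PropositionalEquality
  using (_≡_; refl; sym; trans; cong; cong₂; subst; module ≡-Reasoning)

shiftCol : ℕ → Cell → Cell
shiftCol δ (a , b) = a , δ + b

shiftCol-injective : ∀ δ {u v} → shiftCol δ u ≡ shiftCol δ v → u ≡ v
shiftCol-injective δ {a , b} {a' , b'} eq =
  cong₂ _,_ (cong proj₁ eq) (+-cancelˡ-≡ δ b b' (cong proj₂ eq))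

∈-shift⁻ : ∀ δ {u xs} → shiftCol δ u ∈ map (shiftCol δ) xs → u ∈ xs
∈-shift⁻ δ m with ∈-map⁻ (shiftCol δ) m
... | v , v∈xs , eq = subst (_∈ _) (sym (shiftCol-injective δ eq)) v∈xs

tCells-shift : ∀ o r c δ → tCells o r (δ + c) ≡ map (shiftCol δ) (tCells o r c)
tCells-shift stemDown  r c δ rewrite +-assoc δ c 1 | +-assoc δ c 2 = refl
tCells-shift stemUp    r c δ rewrite +-assoc δ c 1 | +-assoc δ c 2 = refl
tCells-shift stemRight r c δ rewrite +-assoc δ c 1 = refl
tCells-shift stemLeft  r c δ rewrite +-assoc δ c 1 = refl

tShape : Orientation → List (Fin 3 × Fin 3)
tShape stemDown  = (zero , zero) ∷ (zero , suc zero) ∷ (zero , suc (suc zero)) ∷ (suc zero , suc zero) ∷ []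
tShape stemUp    = (suc zero , zero) ∷ (suc zero , suc zero) ∷ (suc zero , suc (suc zero)) ∷ (zero , suc zero) ∷ []
tShape stemRight = (zero , zero) ∷ (suc zero , zero) ∷ (suc (suc zero) , zero) ∷ (suc zero , suc zero) ∷ []
tShape stemLeft  = (zero , suc zero) ∷ (suc zero , suc zero) ∷ (suc (suc zero) , suc zero) ∷ (suc zero , zero) ∷ []

offset : ℕ → ℕ → Fin 3 × Fin 3 → Cell
offset r c (i , j) = r + toℕ i , c + toℕ j

tCells-offsets : ∀ o r c → tCells o r c ≡ map (offset r c) (tShape o)
tCells-offsets stemDown  r c rewrite +-identityʳ r | +-identityʳ c = refl
tCells-offsets stemUp    r c rewrite +-identityʳ r | +-identityʳ c = refl
tCells-offsets stemRight r c rewrite +-identityʳ r | +-identityʳ c = refl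
tCells-offsets stemLeft  r c rewrite +-identityʳ r | +-identityʳ c = refl

tCells-bounds : ∀ o r c {a b} → (a , b) ∈ tCells o r c → r ≤ a × c ≤ b × b ≤ 2 + c
tCells-bounds o r c m rewrite tCells-offsets o r c with ∈-map⁻ (offset r c) m
... | (i , j) , _ , refl =
  m≤m+n r (toℕ i) , m≤m+n c (toℕ j) ,
  subst (c + toℕ j ≤_) (+-comm c 2) (+-monoʳ-≤ c (toℕ≤pred[n] j))

all-or-witness : ∀ {X G : Set} {B : X → Set} → (∀ x → G ⊎ B x) →
                 (xs : List X) → G ⊎ (∀ {x} → x ∈ xs → B x)
all-or-witness decide [] = inj₂ λ ()
all-or-witness decide (x ∷ xs) with decide x | all-or-witness decide xs
... | inj₁ g  | _        = inj₁ g
... | inj₂ _  | inj₁ g   = inj₁ g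
... | inj₂ bx | inj₂ bxs = inj₂ λ { (here refl) → bx ; (there m) → bxs m }

-- Backtracking search.  Cells x are to be assigned choices from `choices x`
-- such that any two assigned choices agree (in both directions).

module Backtracking {X A : Set} (choices : X → List A)
                    (Agree : A → A → Set) (agree? : ∀ a b → Dec (Agree a b)) where

  Consistent : A → List A → Set
  Consistent a done = All (λ b → Agree a b × Agree b a) done

  consistent? : ∀ a done → Dec (Consistent a done)
  consistent? a done = all? (λ b → agree? a b ×-dec agree? b a) done

  Refuted : List A → List X → Set
  Refuted done []       = ⊥
  Refuted done (x ∷ xs) =
    All (λ a → Consistent a done → Refuted (a ∷ done) xs) (choices x)

  refuted? : ∀ done xs → Dec (Refuted done xs)
  refuted? done []       = no λ ()
  refuted? done (x ∷ xs) =
    all? (λ a → consistent? a done →-dec refuted? (a ∷ done) xs) (choices x)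

  refuted-sound : (f : X → A) → (∀ x → f x ∈ choices x) → (∀ x y → Agree (f x) (f y)) →
                  ∀ ys xs → Refuted (map f ys) xs → ⊥
  refuted-sound f f-choice f-agree ys (x ∷ xs) refuted =
    refuted-sound f f-choice f-agree (x ∷ ys) xs
      (All.lookup refuted (f-choice x) (map⁺ (tabulate λ {y} _ → f-agree x y , f-agree y x)))

Placement : Set
Placement = Orientation × ℕ × ℕ

cells : Placement → List Cell
cells (o , r , d) = tCells o r d

Fits : Placement → Set
Fits p = All (λ z → proj₁ z < 3) (cells p)

orientations : List Orientation
orientations = stemDown ∷ stemUp ∷ stemRight ∷ stemLeft ∷ []

∈-orientations : ∀ o → o ∈ orientations
∈-orientations stemDown  = here refl
∈-orientations stemUp    = there (here refl)
∈-orientations stemRight = there (there (here refl))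
∈-orientations stemLeft  = there (there (there (here refl)))

fits? : ∀ p → Dec (Fits p)
fits? p = all? (λ z → proj₁ z <? 3) (cells p)

placements : List Placement
placements =
  filter fits?
         (cartesianProduct orientations (cartesianProduct (upTo 3) (upTo 5)))

-- The box cell in row a and j-th box column sits in column 2 + j of the window.
BoxCell : Set
BoxCell = Fin 3 × Fin 3

inWindow : BoxCell → Cell
inWindow (a , j) = toℕ a , 2 + toℕ j

boxCells : List BoxCell
boxCells = cartesianProduct (allFin 3) (allFin 3)

∈-boxCells : ∀ x → x ∈ boxCells
∈-boxCells (a , j) = ∈-cartesianProduct⁺ (∈-allFin a) (∈-allFin j)

covers? : ∀ x p → Dec (inWindow x ∈ cells p)
covers? x p = inWindow x ∈? cells p

candidates : BoxCell → List Placement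
candidates x = filter (covers? x) placements

Agree : Placement → Placement → Set
Agree p q = Any (_∈ cells q) (cells p) → All (_∈ cells q) (cells p)

agree? : ∀ p q → Dec (Agree p q)
agree? p q = any? (_∈? cells q) (cells p) →-dec all? (_∈? cells q) (cells p)

open Backtracking candidates Agree agree? using (refuted?; refuted-sound)

window-untileable : (f : BoxCell → Placement) → (∀ x → f x ∈ candidates x) →
                    (∀ x y → Agree (f x) (f y)) → ⊥
window-untileable f f-candidate f-agree =
  refuted-sound f f-candidate f-agree [] boxCells (toWitness {a? = refuted? [] boxCells} _)

module _ {n : ℕ} (t : Tiling n) (k : ℕ) (box-inside : k + 3 ≤ n) where
  open Tiling t

  Piece : Set
  Piece = Fin (length pieces)

  MonominoInBox : Set
  MonominoInBox = Σ Piece λ i → Σ ℕ λ r → Σ ℕ λ c →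
    (lookup pieces i ≡ (r , c) ∷ []) × (k ≤ c) × (c < k + 3)

  boxCell : BoxCell → Cell
  boxCell (a , j) = toℕ a , k + toℕ j

  boxCell-inside : ∀ x → InRect n (boxCell x)
  boxCell-inside (a , j) = toℕ<n a , <-≤-trans (+-monoʳ-< k (toℕ<n j)) box-inside

  boxCell-frame : ∀ x → shiftCol 2 (boxCell x) ≡ shiftCol k (inWindow x)
  boxCell-frame (a , j) = cong (toℕ a ,_) (begin
    2 + (k + toℕ j)  ≡⟨ sym (+-assoc 2 k (toℕ j)) ⟩
    (2 + k) + toℕ j  ≡⟨ cong (_+ toℕ j) (+-comm 2 k) ⟩
    (k + 2) + toℕ j  ≡⟨ +-assoc k 2 (toℕ j) ⟩
    k + (2 + toℕ j)  ∎)
    where open ≡-Reasoning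

  coverOf : BoxCell → Piece
  coverOf x = proj₁ (covers (boxCell x) (boxCell-inside x))

  coverOf-∈ : ∀ x → boxCell x ∈ lookup pieces (coverOf x)
  coverOf-∈ x = proj₁ (proj₂ (covers (boxCell x) (boxCell-inside x)))

  shared-cell : ∀ {i i' w} → w ∈ lookup pieces i → w ∈ lookup pieces i' → i ≡ i'
  shared-cell {i} {i'} {w} w∈i w∈i' with covers w (inside i w w∈i)
  ... | _ , _ , unique = trans (unique i w∈i) (sym (unique i' w∈i'))

  Describes : Piece → Placement → Set
  Describes i p = map (shiftCol 2) (lookup pieces i) ↭ map (shiftCol k) (cells p)

  describe : ∀ {i o r c a j} → lookup pieces i ↭ tCells o r c →
             (a , k + j) ∈ tCells o r c → Σ Placement (Describes i)
  describe {i} {o} {r} {c} {a} {j} π m =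
    (o , r , d) , subst (map (shiftCol 2) (lookup pieces i) ↭_) frame (↭.map⁺ (shiftCol 2) π)
    where
      k≤2+c : k ≤ 2 + c
      k≤2+c = ≤-trans (m≤m+n k j) (proj₂ (proj₂ (tCells-bounds o r c m)))
      d : ℕ
      d = 2 + c ∸ k
      open ≡-Reasoning
      frame : map (shiftCol 2) (tCells o r c) ≡ map (shiftCol k) (tCells o r d)
      frame = begin
        map (shiftCol 2) (tCells o r c)  ≡⟨ sym (tCells-shift o r c 2) ⟩
        tCells o r (2 + c)               ≡⟨ cong (tCells o r) (sym (m+[n∸m]≡n k≤2+c)) ⟩
        tCells o r (k + d)               ≡⟨ tCells-shift o r d k ⟩
        map (shiftCol k) (tCells o r d)  ∎

  from-window : ∀ {i p z} → Describes i p → z ∈ cells p →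
                ∃ λ w → w ∈ lookup pieces i × shiftCol 2 w ≡ shiftCol k z
  from-window D z∈p with ∈-map⁻ (shiftCol 2) (↭.∈-resp-↭ (↭-sym D) (∈-map⁺ (shiftCol k) z∈p))
  ... | w , w∈i , eq = w , w∈i , sym eq

  to-window : ∀ {i p z w} → Describes i p → w ∈ lookup pieces i →
              shiftCol 2 w ≡ shiftCol k z → z ∈ cells p
  to-window {p = p} D w∈i eq = ∈-shift⁻ k (subst (_∈ map (shiftCol k) (cells p)) eq (↭.∈-resp-↭ D (∈-map⁺ (shiftCol 2) w∈i)))

  meeting-pieces : ∀ {i i' p q} → Describes i p → Describes i' q →
                   Any (_∈ cells q) (cells p) → i ≡ i'
  meeting-pieces {i' = i'} D D' meet with find meet
  ... | z , z∈p , z∈q with from-window D z∈p | from-window D' z∈q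
  ... | w , w∈i , eq | w' , w'∈i' , eq' =
    shared-cell w∈i (subst (_∈ lookup pieces i') (shiftCol-injective 2 (trans eq' (sym eq))) w'∈i')

  describes-agree : ∀ {i i' p q} → Describes i p → Describes i' q → Agree p q
  describes-agree D D' meet with meeting-pieces D D' meet
  ... | refl = tabulate λ u∈p → let w , w∈i , eq = from-window D u∈p in to-window D' w∈i eq

  describes-fits : ∀ {i p} → Describes i p → Fits p
  describes-fits {i} D = tabulate λ z∈p →
    let w , w∈i , eq = from-window D z∈p in
    subst (_< 3) (cong proj₁ eq) (proj₁ (inside i w w∈i))

  describes-candidate : ∀ x {p} → Describes (coverOf x) p → p ∈ candidates x
  describes-candidate (a , j) {o , r , d} D =
    ∈-filter⁺ (covers? (a , j)) (∈-filter⁺ fits? (∈-cartesianProduct⁺ (∈-orientations o)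
                                 (∈-cartesianProduct⁺ (∈-upTo⁺ r<3) (∈-upTo⁺ d<5)))
                             (describes-fits D))
                x∈p
    where
      x∈p : inWindow (a , j) ∈ tCells o r d
      x∈p = to-window D (coverOf-∈ (a , j)) (boxCell-frame (a , j))
      r<3 : r < 3
      r<3 = ≤-<-trans (proj₁ (tCells-bounds o r d x∈p)) (toℕ<n a)
      d<5 : d < 5
      d<5 = ≤-<-trans (proj₁ (proj₂ (tCells-bounds o r d x∈p))) (+-monoʳ-< 2 (toℕ<n j))

  classify : ∀ x → MonominoInBox ⊎ Σ Placement (Describes (coverOf x))
  classify (a , j) with shape (coverOf (a , j))
  ... | inj₁ (o , r , c , π) = inj₂ (describe π (↭.∈-resp-↭ π (coverOf-∈ (a , j))))
  ... | inj₂ (w , eq) with subst (boxCell (a , j) ∈_) eq (coverOf-∈ (a , j))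
  ... | here refl =
    inj₁ (coverOf (a , j) , toℕ a , k + toℕ j , eq , m≤m+n k (toℕ j) , +-monoʳ-< k (toℕ<n j))

  box-has-monomino : MonominoInBox
  box-has-monomino with all-or-witness classify boxCells
  ... | inj₁ found     = found
  ... | inj₂ described =
    ⊥-elim (window-untileable placement (λ x → describes-candidate x (describes x))
                                         (λ x y → describes-agree (describes x) (describes y)))
    where
      placement : BoxCell → Placement
      placement x = proj₁ (described (∈-boxCells x))
      describes : ∀ x → Describes (coverOf x) (placement x)
      describes x = proj₂ (described (∈-boxCells x))

lemma1 : (n : ℕ) → 3 ≤ n → (t : Tiling n) → (k : ℕ) → k + 3 ≤ n →
    Σ (Fin (length (Tiling.pieces t))) λ i → Σ ℕ λ r → Σ ℕ λ c →
      (lookup (Tiling.pieces t) i ≡ (r , c) ∷ []) × (k ≤ c) × (c < k + 3)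
lemma1 n _ t k box-inside = box-has-monomino t k box-inside
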